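{- Let $a,b,c$ be positive integers with $a\le b\le c$ and $b\ge 2$. Then $\mathrm{rad}(\theta_{a,b,c})=\lfloor (a+c)/2\rfloor$ and $\mathrm{diam}(\theta_{a,b,c})=\lfloor (b+c)/2\rfloor$. Consequently, $\theta_{a,b,c}$ is self-centered if and only if $b=a$ when $a+c$ is odd, and $b\le a+1$ when $a+c$ is even. Also, $\mathrm{diam}(\theta_{a,b,c})=\mathrm{rad}(\theta_{a,b,c})+1$ if and only if $a+1\le b\le a+2$ when $a+c$ is odd, and $a+2\le b\le a+3$ when $a+c$ is even.
   Context: $\theta_{a,b,c}$ denotes the theta graph consisting of three internally vertex-disjoint paths of lengths $a,b,c$ sharing the same two endpoints. For a connected graph, the eccentricity of a vertex $v$ is the maximum distance from $v$ to another vertex; the radius $\mathrm{rad}$ is the minimum eccentricity and the diameter $\mathrm{diam}$ the maximum eccentricity. A graph is self-centered if its radius equals its diameter. -}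

module Defs where

open import Data.Nat using (ℕ; zero; suc; _+_; _≤_; pred)
open import Data.Fin using (Fin; toℕ)
open import Data.Product using (Σ; _×_; ∃)
open import Data.Sum using (_⊎_)
open import Relation.Binary.PropositionalEquality using (_≡_)

module GraphNotions (V : Set) (Adj : V → V → Set) where

  data Walk : V → V → ℕ → Set where
    here : ∀ {u} → Walk u u 0
    step : ∀ {u w v k} → Adj u w → Walk w v k → Walk u v (suc k)

  IsDist : V → V → ℕ → Set
  IsDist u v d = Walk u v d × (∀ k → Walk u v k → d ≤ k)

  IsEcc : V → ℕ → Set
  IsEcc u e = (∀ v d → IsDist u v d → d ≤ e) × (∃ λ v → IsDist u v e)

  IsRad : ℕ → Set
  IsRad r = (∃ λ u → IsEcc u r) × (∀ u e → IsEcc u e → r ≤ e)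

  IsDiam : ℕ → Set
  IsDiam D = (∃ λ u → IsEcc u D) × (∀ u e → IsEcc u e → e ≤ D)

  SelfCentered : Set
  SelfCentered = ∃ λ r → IsRad r × IsDiam r

  DiamIsRadPlusOne : Set
  DiamIsRadPlusOne = ∃ λ r → IsRad r × IsDiam (suc r)

-- The theta graph θ_{a,b,c}: endpoints src, tgt joined by three
-- internally disjoint paths P₀, P₁, P₂ of lengths a, b, c.

len : ℕ → ℕ → ℕ → Fin 3 → ℕ
len a b c Fin.zero = a
len a b c (Fin.suc Fin.zero) = b
len a b c (Fin.suc (Fin.suc Fin.zero)) = c

-- vertices: the two endpoints, and internal vertex  mid p i  which is
-- the vertex at position  suc (toℕ i)  (1 .. len p - 1) on path p
data ThetaV (a b c : ℕ) : Set where
  src : ThetaV a b c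
  tgt : ThetaV a b c
  mid : (p : Fin 3) → Fin (pred (len a b c p)) → ThetaV a b c

data ThetaEdge (a b c : ℕ) : ThetaV a b c → ThetaV a b c → Set where
  direct   : ∀ p → len a b c p ≡ 1 → ThetaEdge a b c src tgt
  first    : ∀ p i → toℕ i ≡ 0 → ThetaEdge a b c src (mid p i)
  inner    : ∀ p i j → toℕ j ≡ suc (toℕ i) → ThetaEdge a b c (mid p i) (mid p j)
  last     : ∀ p i → toℕ i + 2 ≡ len a b c p → ThetaEdge a b c (mid p i) tgt

ThetaAdj : (a b c : ℕ) → ThetaV a b c → ThetaV a b c → Set
ThetaAdj a b c u v = ThetaEdge a b c u v ⊎ ThetaEdge a b c v u

module Theta (a b c : ℕ) = GraphNotions (ThetaV a b c) (ThetaAdj a b c)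

-- Every vertex of θ_{a,b,c} sits at some position on one of the three paths,
-- and a shortest walk out of a vertex either stays on its own path or leaves
-- it through src or tgt.  This gives a closed formula δ for the distance: it
-- is realised by explicit walks, vanishes on the diagonal and changes by at
-- most one along every edge, so no walk is shorter.  From the formula, src
-- has eccentricity ⌊(a+c)/2⌋ (its antipode on the cycle P_a ∪ P_c) and every
-- vertex has some vertex at least that far away, while every distance is at
-- most ⌊(b+c)/2⌋, attained by the midpoint of P_b and its antipode on the
-- cycle P_b ∪ P_c.  The two characterisations are then parity bookkeeping on
-- ⌊(a+c+t)/2⌋ with b = a + t.
module Submission where

open import Defs
open import Data.Nat
  using ( ℕ; zero; suc; pred; _+_; _*_; _∸_; _⊓_; _≤_; _<_; _≤?_; _<?_; z≤n; s≤s; s≤s⁻¹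
        ; ⌊_/2⌋; ⌈_/2⌉; ∣_-_∣)
open import Data.Nat.Properties
open import Algebra.Properties.CommutativeSemigroup +-commutativeSemigroup using (interchange; x∙yz≈y∙xz)
open import Data.Nat.Divisibility using (_∣_; divides; ∣m+n∣m⇒∣n; ∣1⇒≡1)
open import Data.Nat.Tactic.RingSolver using (solve-∀)
open import Data.Fin as Fin using (Fin; toℕ; fromℕ<)
open import Data.Fin.Properties using (toℕ-fromℕ<; fromℕ<-toℕ; toℕ<n)
open import Data.Product using (∃; ∃₂; _×_; _,_; proj₁; proj₂)
open import Data.Product.Function.NonDependent.Propositional using (_×-⇔_)
open import Data.Sum using (_⊎_; inj₁; inj₂; swap)
open import Data.Empty using (⊥-elim)
open import Relation.Nullary using (¬_; yes; no)
open import Relation.Binary.PropositionalEquality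
open import Function.Bundles using (_⇔_; mk⇔; Equivalence)
import Function.Properties.Equivalence as ⇔
import Relation.Binary.Reasoning.Setoid as SetoidReasoning
open import Level using (0ℓ)

module ⇔-Reasoning = SetoidReasoning (⇔.⇔-setoid 0ℓ)

-- Walks and distances in an undirected graph

module WalkOperations {V : Set} {Adj : V → V → Set}
                      (Adj-sym : ∀ {u v} → Adj u v → Adj v u) where
  open GraphNotions V Adj

  cast : ∀ {u v m n} → m ≡ n → Walk u v m → Walk u v n
  cast refl p = p

  _++_ : ∀ {u v w m n} → Walk u v m → Walk v w n → Walk u w (m + n)
  here     ++ q = q
  step e p ++ q = step e (p ++ q)

  reverse : ∀ {u v k} → Walk u v k → Walk v u k
  reverse here                = here
  reverse {k = suc k} (step e p) = cast (+-comm k 1) (reverse p ++ step (Adj-sym e) here)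

  shorter : ∀ {u v m n} → Walk u v m → Walk u v n → Walk u v (m ⊓ n)
  shorter {m = m} {n} p q with ≤-total m n
  ... | inj₁ m≤n = cast (sym (m≤n⇒m⊓n≡m m≤n)) p
  ... | inj₂ n≤m = cast (sym (m≥n⇒m⊓n≡n n≤m)) q

module DistanceCharacterisation {V : Set} {Adj : V → V → Set} where
  open GraphNotions V Adj

  IsRad-unique : ∀ {r r′} → IsRad r → IsRad r′ → r ≡ r′
  IsRad-unique ((u , ecc) , least) ((u′ , ecc′) , least′) =
    ≤-antisym (least u′ _ ecc′) (least′ u _ ecc)

  IsDiam-unique : ∀ {D D′} → IsDiam D → IsDiam D′ → D ≡ D′
  IsDiam-unique ((u , ecc) , greatest) ((u′ , ecc′) , greatest′) =
    ≤-antisym (greatest′ u _ ecc) (greatest u′ _ ecc′)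

  selfCentered⇔ : ∀ {r D} → IsRad r → IsDiam D → SelfCentered ⇔ (r ≡ D)
  selfCentered⇔ rad diam = mk⇔
    (λ (_ , rad′ , diam′) → trans (IsRad-unique rad rad′) (IsDiam-unique diam′ diam))
    (λ { refl → _ , rad , diam })

  diamIsRadPlusOne⇔ : ∀ {r D} → IsRad r → IsDiam D → DiamIsRadPlusOne ⇔ (D ≡ suc r)
  diamIsRadPlusOne⇔ rad diam = mk⇔
    (λ (_ , rad′ , diam′) → trans (IsDiam-unique diam diam′) (cong suc (IsRad-unique rad′ rad)))
    (λ { refl → _ , rad , diam })

  module ByDistanceFunction (δ : V → V → ℕ)
           (δ-self : ∀ u → δ u u ≡ 0)
           (δ-lipschitz : ∀ u {w w′} → Adj w w′ → δ u w′ ≤ suc (δ u w))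
           (δ-walk : ∀ u v → Walk u v (δ u v)) where

    δ≤δ+length : ∀ u {w v k} → Walk w v k → δ u v ≤ δ u w + k
    δ≤δ+length u {w} here = m≤m+n (δ u w) 0
    δ≤δ+length u {w} {v} (step {w = w′} {k = k} e p) = begin
      δ u v            ≤⟨ δ≤δ+length u p ⟩
      δ u w′ + k       ≤⟨ +-monoˡ-≤ k (δ-lipschitz u e) ⟩
      suc (δ u w) + k  ≡⟨ +-suc (δ u w) k ⟨
      δ u w + suc k    ∎
      where open ≤-Reasoning

    δ≤length : ∀ {u v k} → Walk u v k → δ u v ≤ k
    δ≤length {u} {v} {k} p = subst (λ d → δ u v ≤ d + k) (δ-self u) (δ≤δ+length u p)

    isDist : ∀ u v → IsDist u v (δ u v)
    isDist u v = δ-walk u v , λ _ → δ≤length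

    isDist⇒≡δ : ∀ {u v d} → IsDist u v d → d ≡ δ u v
    isDist⇒≡δ {u} {v} (p , shortest) = ≤-antisym (shortest _ (δ-walk u v)) (δ≤length p)

    isEcc : ∀ {u e} → (∀ v → δ u v ≤ e) → (∃ λ v → δ u v ≡ e) → IsEcc u e
    isEcc {u} {e} bound (v , refl) =
      (λ w d dist → subst (_≤ e) (sym (isDist⇒≡δ dist)) (bound w)) , v , isDist u v

    isRad : ∀ {u r} → (∀ v → δ u v ≤ r) → (∃ λ v → δ u v ≡ r) →
            (∀ w → ∃ λ v → r ≤ δ w v) → IsRad r
    isRad {u} {r} bound attained far = (u , isEcc bound attained) , least
      where
      least : ∀ w e → IsEcc w e → r ≤ e
      least w e (bounded , _) = ≤-trans (proj₂ (far w)) (bounded _ _ (isDist w (proj₁ (far w))))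

    isDiam : ∀ {D} → (∀ w v → δ w v ≤ D) → (∃₂ λ u v → δ u v ≡ D) → IsDiam D
    isDiam {D} bound (u , v , attained) = (u , isEcc (bound u) (v , attained)) , greatest
      where
      greatest : ∀ w e → IsEcc w e → e ≤ D
      greatest w e (_ , v′ , dist) = subst (_≤ D) (sym (isDist⇒≡δ dist)) (bound w v′)

≤-by-balance : ∀ {A B P Q} → A ≤ B → P + B ≡ Q + A → P ≤ Q
≤-by-balance {A} {B} {P} {Q} A≤B balance = +-cancelˡ-≤ A P Q (begin
  A + P  ≡⟨ +-comm A P ⟩
  P + A  ≤⟨ +-monoʳ-≤ P A≤B ⟩
  P + B  ≡⟨ balance ⟩
  Q + A  ≡⟨ +-comm Q A ⟩
  A + Q  ∎)
  where open ≤-Reasoning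

y+z≡n⇒n∸y≡z : ∀ {y z n} → y + z ≡ n → n ∸ y ≡ z
y+z≡n⇒n∸y≡z {y} {z} y+z≡n = trans (cong (_∸ y) (sym y+z≡n)) (m+n∸m≡n y z)

≤⌊/2⌋ : ∀ {k n} → k + k ≤ n → k ≤ ⌊ n /2⌋
≤⌊/2⌋ {k} {n} k+k≤n = subst (_≤ ⌊ n /2⌋) (sym (n≡⌊n+n/2⌋ k)) (⌊n/2⌋-mono k+k≤n)

m⊓n≤⌊m+n/2⌋ : ∀ m n → m ⊓ n ≤ ⌊ (m + n) /2⌋
m⊓n≤⌊m+n/2⌋ m n = ≤⌊/2⌋ (+-mono-≤ (m⊓n≤m m n) (m⊓n≤n m n))

⌊n/2⌋+⌊n/2⌋≤n : ∀ n → ⌊ n /2⌋ + ⌊ n /2⌋ ≤ n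
⌊n/2⌋+⌊n/2⌋≤n n = ≤-trans (+-monoʳ-≤ ⌊ n /2⌋ (⌊n/2⌋≤⌈n/2⌉ n)) (≤-reflexive (⌊n/2⌋+⌈n/2⌉≡n n))

n≤1+⌊n/2⌋+⌊n/2⌋ : ∀ n → n ≤ suc (⌊ n /2⌋ + ⌊ n /2⌋)
n≤1+⌊n/2⌋+⌊n/2⌋ n = begin
  n                          ≡⟨ ⌊n/2⌋+⌈n/2⌉≡n n ⟨
  ⌊ n /2⌋ + ⌈ n /2⌉          ≤⟨ +-monoʳ-≤ ⌊ n /2⌋ (⌈n/2⌉≤1+⌊n/2⌋ n) ⟩
  ⌊ n /2⌋ + suc ⌊ n /2⌋      ≡⟨ +-suc ⌊ n /2⌋ ⌊ n /2⌋ ⟩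
  suc (⌊ n /2⌋ + ⌊ n /2⌋)    ∎
  where
  open ≤-Reasoning
  ⌈n/2⌉≤1+⌊n/2⌋ : ∀ n → ⌈ n /2⌉ ≤ suc ⌊ n /2⌋
  ⌈n/2⌉≤1+⌊n/2⌋ zero          = z≤n
  ⌈n/2⌉≤1+⌊n/2⌋ (suc zero)    = s≤s z≤n
  ⌈n/2⌉≤1+⌊n/2⌋ (suc (suc n)) = s≤s (⌈n/2⌉≤1+⌊n/2⌋ n)

1≤⌊n/2⌋ : ∀ {n} → 2 ≤ n → 1 ≤ ⌊ n /2⌋
1≤⌊n/2⌋ (s≤s (s≤s _)) = s≤s z≤n

⌊n/2⌋∸1<pred[n] : ∀ {n} → 2 ≤ n → ⌊ n /2⌋ ∸ 1 < pred n
⌊n/2⌋∸1<pred[n] {suc (suc n)} (s≤s (s≤s _)) = s≤s (⌊n/2⌋≤n n)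

⌊k+k+m/2⌋≡k+⌊m/2⌋ : ∀ k m → ⌊ (k + k + m) /2⌋ ≡ k + ⌊ m /2⌋
⌊k+k+m/2⌋≡k+⌊m/2⌋ zero    m = refl
⌊k+k+m/2⌋≡k+⌊m/2⌋ (suc k) m =
  trans (cong (λ t → ⌊ suc t + m /2⌋) (+-suc k k)) (cong suc (⌊k+k+m/2⌋≡k+⌊m/2⌋ k m))

x+[d+[n∸y]]+[y∸x]≡d+n : ∀ d {x y n} → x ≤ y → y ≤ n → x + (d + (n ∸ y)) + (y ∸ x) ≡ d + n
x+[d+[n∸y]]+[y∸x]≡d+n d {x} {y} {n} x≤y y≤n = begin
  x + (d + (n ∸ y)) + (y ∸ x)  ≡⟨ shuffle x d (n ∸ y) (y ∸ x) ⟩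
  d + ((x + (y ∸ x)) + (n ∸ y)) ≡⟨ cong (λ t → d + (t + (n ∸ y))) (m+[n∸m]≡n x≤y) ⟩
  d + (y + (n ∸ y))             ≡⟨ cong (d +_) (m+[n∸m]≡n y≤n) ⟩
  d + n                         ∎
  where
  open ≡-Reasoning
  shuffle : ∀ x d u v → x + (d + u) + v ≡ d + ((x + v) + u)
  shuffle = solve-∀

[n∸x]+[d+y]+[x∸y]≡d+n : ∀ d {x y n} → y ≤ x → x ≤ n → (n ∸ x) + (d + y) + (x ∸ y) ≡ d + n
[n∸x]+[d+y]+[x∸y]≡d+n d {x} {y} {n} y≤x x≤n = begin
  (n ∸ x) + (d + y) + (x ∸ y)  ≡⟨ shuffle (n ∸ x) d y (x ∸ y) ⟩
  d + ((y + (x ∸ y)) + (n ∸ x)) ≡⟨ cong (λ t → d + (t + (n ∸ x))) (m+[n∸m]≡n y≤x) ⟩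
  d + (x + (n ∸ x))             ≡⟨ cong (d +_) (m+[n∸m]≡n x≤n) ⟩
  d + n                         ∎
  where
  open ≡-Reasoning
  shuffle : ∀ u d y v → u + (d + y) + v ≡ d + ((y + v) + u)
  shuffle = solve-∀

WithinOne : ℕ → ℕ → Set
WithinOne m n = m ≤ suc n × n ≤ suc m

withinOne-refl : ∀ m → WithinOne m m
withinOne-refl m = n≤1+n m , n≤1+n m

withinOne-sym : ∀ {m n} → WithinOne m n → WithinOne n m
withinOne-sym (m≤ , n≤) = n≤ , m≤

withinOne-suc : ∀ m → WithinOne m (suc m)
withinOne-suc m = m≤n⇒m≤1+n (n≤1+n m) , ≤-refl

withinOne-⊓ : ∀ {m n m′ n′} → WithinOne m n → WithinOne m′ n′ → WithinOne (m ⊓ m′) (n ⊓ n′)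
withinOne-⊓ (m≤ , n≤) (m′≤ , n′≤) = ⊓-mono-≤ m≤ m′≤ , ⊓-mono-≤ n≤ n′≤

-- A third term may enter the minimum on one side as long as it cannot pull
-- that side more than one below the other.
withinOne-⊓-extend : ∀ {m n m′ n′ e} → WithinOne m n → WithinOne m′ n′ → m ⊓ m′ ≤ suc e →
                     WithinOne (m ⊓ m′) ((n ⊓ n′) ⊓ e)
withinOne-⊓-extend (m≤ , n≤) (m′≤ , n′≤) ≤e =
  ⊓-glb (⊓-mono-≤ m≤ m′≤) ≤e , ≤-trans (m⊓n≤m _ _) (⊓-mono-≤ n≤ n′≤)

≤1+⊓ : ∀ {k m n} → k ≤ suc m → k ≤ suc n → k ≤ suc (m ⊓ n)
≤1+⊓ = ⊓-glb

withinOne-+ : ∀ k {m n} → WithinOne m n → WithinOne (k + m) (k + n)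
withinOne-+ k {m} {n} (m≤ , n≤) =
  subst (k + m ≤_) (+-suc k n) (+-monoʳ-≤ k m≤) , subst (k + n ≤_) (+-suc k m) (+-monoʳ-≤ k n≤)

withinOne-∸ : ∀ m n → WithinOne (m ∸ n) (m ∸ suc n)
withinOne-∸ zero    zero    = withinOne-refl 0
withinOne-∸ zero    (suc n) = withinOne-refl 0
withinOne-∸ (suc m) zero    = withinOne-sym (withinOne-suc m)
withinOne-∸ (suc m) (suc n) = withinOne-∸ m n

withinOne-∣-∣ : ∀ m n → WithinOne ∣ m - n ∣ ∣ m - suc n ∣
withinOne-∣-∣ zero    n       = withinOne-suc n
withinOne-∣-∣ (suc m) zero    rewrite ∣-∣-identityʳ m = withinOne-sym (withinOne-suc m)
withinOne-∣-∣ (suc m) (suc n) = withinOne-∣-∣ m n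

-- r bounds the four routes from position x on one path (x′ to its other end)
-- to position y on a path (z to its other end): out through src or tgt, then
-- either directly or around a detour of length a between src and tgt.
record RoutesAtLeast (r x x′ y z a : ℕ) : Set where
  constructor mkRoutes
  field
    viaSrc       : r ≤ x + y
    viaSrcAround : r ≤ x + (a + z)
    viaTgt       : r ≤ x′ + z
    viaTgtAround : r ≤ x′ + (a + y)

routesAtLeast-flip : ∀ {r x x′ y z a} → RoutesAtLeast r x x′ y z a → RoutesAtLeast r x′ x z y a
routesAtLeast-flip (mkRoutes r≤₁ r≤₂ r≤₃ r≤₄) = mkRoutes r≤₃ r≤₄ r≤₁ r≤₂

-- The target lies r − x beyond src on another path of length y + z.
routesAtLeast-across : ∀ x x′ a r y z → a ≤ x + x′ → r + r ≤ a + (y + z) → r ≤ y + z →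
                       x ≤ x′ + a → y ≡ r ∸ x → RoutesAtLeast r x x′ y z a
routesAtLeast-across x x′ a r y z a≤ 2r≤ r≤ x≤ refl with ≤-total r x
... | inj₁ r≤x rewrite m≤n⇒m∸n≡0 r≤x = mkRoutes
  (≤-trans r≤x (m≤m+n x 0))
  (≤-trans r≤x (m≤m+n x _))
  (≤-trans r≤ (m≤n+m z x′))
  (≤-trans r≤x (≤-trans x≤ (≤-reflexive (cong (x′ +_) (sym (+-identityʳ a))))))
... | inj₂ x≤r = subst (λ s → RoutesAtLeast s x x′ (r ∸ x) z a) (m+[n∸m]≡n x≤r) (reached (r ∸ x)
    (subst (λ s → s + s ≤ a + (r ∸ x + z)) (sym (m+[n∸m]≡n x≤r)) 2r≤))
  where
  reached : ∀ y → (x + y) + (x + y) ≤ a + (y + z) → RoutesAtLeast (x + y) x x′ y z a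
  reached y 2r≤′ = mkRoutes
    ≤-refl
    (≤-by-balance (≤-trans 2r≤′ (m≤m+n _ (x + x))) (shuffle₁ x y a z))
    (≤-by-balance (≤-trans 2r≤′ (+-monoˡ-≤ (y + z) a≤)) (shuffle₂ x x′ y z))
    (≤-by-balance (+-monoˡ-≤ y x≤) (shuffle₃ x x′ a y))
    where
    shuffle₁ : ∀ x y a z → (x + y) + (a + (y + z) + (x + x)) ≡ (x + (a + z)) + ((x + y) + (x + y))
    shuffle₁ = solve-∀
    shuffle₂ : ∀ x x′ y z → (x + y) + ((x + x′) + (y + z)) ≡ (x′ + z) + ((x + y) + (x + y))
    shuffle₂ = solve-∀
    shuffle₃ : ∀ x x′ a y → (x + y) + (x′ + a + y) ≡ (x′ + (a + y)) + (x + y)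
    shuffle₃ = solve-∀

-- The target lies r beyond the vertex on its own path.
routesAtLeast-ahead : ∀ x r a z → r + r ≤ a + ((x + r) + z) → RoutesAtLeast r x (r + z) (x + r) z a
routesAtLeast-ahead x r a z 2r≤ = mkRoutes
  (≤-trans (m≤n+m r x) (m≤n+m (x + r) x))
  (≤-by-balance 2r≤ (shuffle r a x z))
  (≤-trans (m≤m+n r z) (m≤m+n (r + z) z))
  (≤-trans (m≤m+n r z) (m≤m+n (r + z) _))
  where
  shuffle : ∀ r a x z → r + (a + ((x + r) + z)) ≡ (x + (a + z)) + (r + r)
  shuffle = solve-∀

-- The target lies on the detour itself, which has length y + z.
routesAtLeast-onDetour : ∀ x x′ y z → (x′ + z) + (x′ + z) ≤ (y + z) + (x + x′) →
                         RoutesAtLeast (x′ + z) x x′ y z (y + z)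
routesAtLeast-onDetour x x′ y z 2r≤ = mkRoutes
  r≤x+y
  (≤-trans r≤x+y (≤-trans (m≤m+n (x + y) (z + z)) (≤-reflexive (shuffle₂ x y z))))
  ≤-refl
  (+-monoʳ-≤ x′ (≤-trans (m≤n+m z y) (m≤m+n (y + z) y)))
  where
  shuffle₁ : ∀ x x′ y z → (x′ + z) + ((y + z) + (x + x′)) ≡ (x + y) + ((x′ + z) + (x′ + z))
  shuffle₁ = solve-∀
  shuffle₂ : ∀ x y z → x + y + (z + z) ≡ x + ((y + z) + z)
  shuffle₂ = solve-∀
  r≤x+y : x′ + z ≤ x + y
  r≤x+y = ≤-by-balance 2r≤ (shuffle₁ x x′ y z)

-- The vertex is the midpoint of a path of length x + x′.
routesAtLeast-midpoint : ∀ x x′ y z a → 1 ≤ a → x + x ≤ x + x′ → x + x′ ≤ suc (x + x) →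
                         (x + y) + (x + y) ≤ (x + x′) + (y + z) → RoutesAtLeast (x + y) x x′ y z a
routesAtLeast-midpoint x x′ y z a 1≤a 2x≤x+x′ x+x′≤1+2x 2r≤ = mkRoutes
  ≤-refl
  (≤-by-balance (≤-trans 2r≤ (+-monoˡ-≤ (y + z) x+x′≤x+x+a)) (shuffle₁ x y a z))
  (≤-by-balance 2r≤ (shuffle₂ x x′ y z))
  (≤-by-balance (+-monoˡ-≤ y (≤-trans (+-cancelˡ-≤ x x x′ 2x≤x+x′) (m≤m+n x′ a))) (shuffle₃ x x′ a y))
  where
  x+x′≤x+x+a : x + x′ ≤ x + x + a
  x+x′≤x+x+a = ≤-trans x+x′≤1+2x (≤-trans (≤-reflexive (+-comm 1 (x + x))) (+-monoʳ-≤ (x + x) 1≤a))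
  shuffle₁ : ∀ x y a z → (x + y) + ((x + x + a) + (y + z)) ≡ (x + (a + z)) + ((x + y) + (x + y))
  shuffle₁ = solve-∀
  shuffle₂ : ∀ x x′ y z → (x + y) + ((x + x′) + (y + z)) ≡ (x′ + z) + ((x + y) + (x + y))
  shuffle₂ = solve-∀
  shuffle₃ : ∀ x x′ a y → (x + y) + (x′ + a + y) ≡ (x′ + (a + y)) + (x + y)
  shuffle₃ = solve-∀

2∣k+k : ∀ k → 2 ∣ k + k
2∣k+k k = divides k (k+k≡k*2 k)
  where
  k+k≡k*2 : ∀ k → k + k ≡ k * 2
  k+k≡k*2 = solve-∀

¬2∣1+k+k : ∀ k → ¬ 2 ∣ suc (k + k)
¬2∣1+k+k k 2∣ with ∣1⇒≡1 (∣m+n∣m⇒∣n (subst (2 ∣_) (+-comm 1 (k + k)) 2∣) (2∣k+k k))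
... | ()

parity : ∀ n → ∃ λ k → n ≡ k + k ⊎ n ≡ suc (k + k)
parity zero = 0 , inj₁ refl
parity (suc n) with parity n
... | k , inj₁ n≡ = k , inj₂ (cong suc n≡)
... | k , inj₂ n≡ = suc k , inj₁ (cong suc (trans n≡ (sym (+-suc k k))))

byParity : ∀ {P Qₒ Qₑ : Set} n →
           (∀ k → n ≡ suc (k + k) → P ⇔ Qₒ) → (∀ k → n ≡ k + k → P ⇔ Qₑ) →
           P ⇔ ((¬ 2 ∣ n × Qₒ) ⊎ (2 ∣ n × Qₑ))
byParity n odd⇔ even⇔ with parity n
... | k , inj₁ refl = mk⇔
  (λ p → inj₂ (2∣k+k k , Equivalence.to (even⇔ k refl) p))
  λ { (inj₁ (¬2∣ , _)) → ⊥-elim (¬2∣ (2∣k+k k))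
    ; (inj₂ (_ , q))   → Equivalence.from (even⇔ k refl) q }
... | k , inj₂ refl = mk⇔
  (λ p → inj₁ (¬2∣1+k+k k , Equivalence.to (odd⇔ k refl) p))
  λ { (inj₁ (_ , q))  → Equivalence.from (odd⇔ k refl) q
    ; (inj₂ (2∣ , _)) → ⊥-elim (¬2∣1+k+k k 2∣) }

⌊1+k+k/2⌋≡k : ∀ k → ⌊ suc (k + k) /2⌋ ≡ k
⌊1+k+k/2⌋≡k zero    = refl
⌊1+k+k/2⌋≡k (suc k) = trans (cong (λ t → ⌊ suc (suc t) /2⌋) (+-suc k k)) (cong suc (⌊1+k+k/2⌋≡k k))

≡⇔≡ : ∀ {x y x′ y′ : ℕ} → x ≡ x′ → y ≡ y′ → (x ≡ y) ⇔ (x′ ≡ y′)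
≡⇔≡ refl refl = ⇔.refl

k≡k+m⇔m≡0 : ∀ k m → (k ≡ k + m) ⇔ (m ≡ 0)
k≡k+m⇔m≡0 k m = mk⇔
  (λ k≡ → +-cancelˡ-≡ k m 0 (trans (sym k≡) (sym (+-identityʳ k))))
  (λ { refl → sym (+-identityʳ k) })

k+m≡1+k⇔m≡1 : ∀ k m → (k + m ≡ suc k) ⇔ (m ≡ 1)
k+m≡1+k⇔m≡1 k m = mk⇔
  (λ ≡1+k → +-cancelˡ-≡ k m 1 (trans ≡1+k (+-comm 1 k)))
  (λ { refl → +-comm k 1 })

m≡0⇔a+m≡a : ∀ a m → (m ≡ 0) ⇔ (a + m ≡ a)
m≡0⇔a+m≡a a m = ⇔.trans (⇔.sym (k≡k+m⇔m≡0 a m)) (mk⇔ sym sym)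

m≤n⇔a+m≤a+n : ∀ a m n → (m ≤ n) ⇔ (a + m ≤ a + n)
m≤n⇔a+m≤a+n a m n = mk⇔ (+-monoʳ-≤ a) (+-cancelˡ-≤ a m n)

⌊t/2⌋≡0⇔t≤1 : ∀ t → (⌊ t /2⌋ ≡ 0) ⇔ (t ≤ 1)
⌊t/2⌋≡0⇔t≤1 t = mk⇔ (to t) (from t)
  where
  to : ∀ t → ⌊ t /2⌋ ≡ 0 → t ≤ 1
  to zero          _ = z≤n
  to (suc zero)    _ = s≤s z≤n
  to (suc (suc t)) ()
  from : ∀ t → t ≤ 1 → ⌊ t /2⌋ ≡ 0
  from zero          _ = refl
  from (suc zero)    _ = refl
  from (suc (suc t)) (s≤s ())

⌊1+t/2⌋≡0⇔t≡0 : ∀ t → (⌊ suc t /2⌋ ≡ 0) ⇔ (t ≡ 0)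
⌊1+t/2⌋≡0⇔t≡0 t = mk⇔ (to t) (λ { refl → refl })
  where
  to : ∀ t → ⌊ suc t /2⌋ ≡ 0 → t ≡ 0
  to zero    _ = refl
  to (suc t) ()

⌊t/2⌋≡1⇔2≤t≤3 : ∀ t → (⌊ t /2⌋ ≡ 1) ⇔ (2 ≤ t × t ≤ 3)
⌊t/2⌋≡1⇔2≤t≤3 t = mk⇔ (to t) (from t)
  where
  to : ∀ t → ⌊ t /2⌋ ≡ 1 → 2 ≤ t × t ≤ 3
  to (suc (suc zero))             _ = s≤s (s≤s z≤n) , s≤s (s≤s z≤n)
  to (suc (suc (suc zero)))       _ = s≤s (s≤s z≤n) , s≤s (s≤s (s≤s z≤n))
  to (suc (suc (suc (suc t))))    ()
  from : ∀ t → 2 ≤ t × t ≤ 3 → ⌊ t /2⌋ ≡ 1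
  from (suc zero)                (s≤s () , _)
  from (suc (suc zero))          _ = refl
  from (suc (suc (suc zero)))    _ = refl
  from (suc (suc (suc (suc t)))) (_ , s≤s (s≤s (s≤s ())))

⌊1+t/2⌋≡1⇔1≤t≤2 : ∀ t → (⌊ suc t /2⌋ ≡ 1) ⇔ (1 ≤ t × t ≤ 2)
⌊1+t/2⌋≡1⇔1≤t≤2 t = mk⇔ (to t) (from t)
  where
  to : ∀ t → ⌊ suc t /2⌋ ≡ 1 → 1 ≤ t × t ≤ 2
  to (suc zero)          _ = s≤s z≤n , s≤s z≤n
  to (suc (suc zero))    _ = s≤s z≤n , s≤s (s≤s z≤n)
  to (suc (suc (suc t))) ()
  from : ∀ t → 1 ≤ t × t ≤ 2 → ⌊ suc t /2⌋ ≡ 1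
  from (suc zero)          _ = refl
  from (suc (suc zero))    _ = refl
  from (suc (suc (suc t))) (_ , s≤s (s≤s ()))

module HalfComparison (a t c : ℕ) where
  open ⇔-Reasoning

  private
    ⌊a+t+c/2⌋≡⌊a+c+t/2⌋ : ⌊ (a + t + c) /2⌋ ≡ ⌊ (a + c + t) /2⌋
    ⌊a+t+c/2⌋≡⌊a+c+t/2⌋ = cong ⌊_/2⌋ (shuffle a t c)
      where
      shuffle : ∀ a t c → a + t + c ≡ a + c + t
      shuffle = solve-∀

    module Even (k : ℕ) (a+c≡ : a + c ≡ k + k) where
      ⌊a+c/2⌋≡k : ⌊ (a + c) /2⌋ ≡ k
      ⌊a+c/2⌋≡k = trans (cong ⌊_/2⌋ a+c≡) (sym (n≡⌊n+n/2⌋ k))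

      ⌊a+t+c/2⌋≡k+⌊t/2⌋ : ⌊ (a + t + c) /2⌋ ≡ k + ⌊ t /2⌋
      ⌊a+t+c/2⌋≡k+⌊t/2⌋ = trans ⌊a+t+c/2⌋≡⌊a+c+t/2⌋
        (trans (cong (λ n → ⌊ (n + t) /2⌋) a+c≡) (⌊k+k+m/2⌋≡k+⌊m/2⌋ k t))

    module Odd (k : ℕ) (a+c≡ : a + c ≡ suc (k + k)) where
      ⌊a+c/2⌋≡k : ⌊ (a + c) /2⌋ ≡ k
      ⌊a+c/2⌋≡k = trans (cong ⌊_/2⌋ a+c≡) (⌊1+k+k/2⌋≡k k)

      ⌊a+t+c/2⌋≡k+⌊1+t/2⌋ : ⌊ (a + t + c) /2⌋ ≡ k + ⌊ suc t /2⌋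
      ⌊a+t+c/2⌋≡k+⌊1+t/2⌋ = trans ⌊a+t+c/2⌋≡⌊a+c+t/2⌋
        (trans (cong (λ n → ⌊ (n + t) /2⌋) a+c≡)
          (trans (cong ⌊_/2⌋ (sym (+-suc (k + k) t))) (⌊k+k+m/2⌋≡k+⌊m/2⌋ k (suc t))))

  sameHalf⇔ : (⌊ (a + c) /2⌋ ≡ ⌊ (a + t + c) /2⌋) ⇔
              ((¬ 2 ∣ (a + c) × a + t ≡ a) ⊎ (2 ∣ (a + c) × a + t ≤ a + 1))
  sameHalf⇔ = byParity (a + c) odd-case even-case
    where
    odd-case : ∀ k → a + c ≡ suc (k + k) → (⌊ (a + c) /2⌋ ≡ ⌊ (a + t + c) /2⌋) ⇔ (a + t ≡ a)
    odd-case k a+c≡ = begin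
      (⌊ (a + c) /2⌋ ≡ ⌊ (a + t + c) /2⌋)  ≈⟨ ≡⇔≡ ⌊a+c/2⌋≡k ⌊a+t+c/2⌋≡k+⌊1+t/2⌋ ⟩
      (k ≡ k + ⌊ suc t /2⌋)               ≈⟨ k≡k+m⇔m≡0 k _ ⟩
      (⌊ suc t /2⌋ ≡ 0)                   ≈⟨ ⌊1+t/2⌋≡0⇔t≡0 t ⟩
      (t ≡ 0)                            ≈⟨ m≡0⇔a+m≡a a t ⟩
      (a + t ≡ a)                        ∎
      where open Odd k a+c≡
    even-case : ∀ k → a + c ≡ k + k → (⌊ (a + c) /2⌋ ≡ ⌊ (a + t + c) /2⌋) ⇔ (a + t ≤ a + 1)
    even-case k a+c≡ = begin
      (⌊ (a + c) /2⌋ ≡ ⌊ (a + t + c) /2⌋)  ≈⟨ ≡⇔≡ ⌊a+c/2⌋≡k ⌊a+t+c/2⌋≡k+⌊t/2⌋ ⟩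
      (k ≡ k + ⌊ t /2⌋)                   ≈⟨ k≡k+m⇔m≡0 k _ ⟩
      (⌊ t /2⌋ ≡ 0)                       ≈⟨ ⌊t/2⌋≡0⇔t≤1 t ⟩
      (t ≤ 1)                            ≈⟨ m≤n⇔a+m≤a+n a t 1 ⟩
      (a + t ≤ a + 1)                    ∎
      where open Even k a+c≡

  nextHalf⇔ : (⌊ (a + t + c) /2⌋ ≡ suc ⌊ (a + c) /2⌋) ⇔
              ((¬ 2 ∣ (a + c) × a + 1 ≤ a + t × a + t ≤ a + 2)
                ⊎ (2 ∣ (a + c) × a + 2 ≤ a + t × a + t ≤ a + 3))
  nextHalf⇔ = byParity (a + c) odd-case even-case
    where
    odd-case : ∀ k → a + c ≡ suc (k + k) →
               (⌊ (a + t + c) /2⌋ ≡ suc ⌊ (a + c) /2⌋) ⇔ (a + 1 ≤ a + t × a + t ≤ a + 2)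
    odd-case k a+c≡ = begin
      (⌊ (a + t + c) /2⌋ ≡ suc ⌊ (a + c) /2⌋)  ≈⟨ ≡⇔≡ ⌊a+t+c/2⌋≡k+⌊1+t/2⌋ (cong suc ⌊a+c/2⌋≡k) ⟩
      (k + ⌊ suc t /2⌋ ≡ suc k)               ≈⟨ k+m≡1+k⇔m≡1 k _ ⟩
      (⌊ suc t /2⌋ ≡ 1)                       ≈⟨ ⌊1+t/2⌋≡1⇔1≤t≤2 t ⟩
      (1 ≤ t × t ≤ 2)                        ≈⟨ m≤n⇔a+m≤a+n a 1 t ×-⇔ m≤n⇔a+m≤a+n a t 2 ⟩
      (a + 1 ≤ a + t × a + t ≤ a + 2)        ∎
      where open Odd k a+c≡
    even-case : ∀ k → a + c ≡ k + k →
                (⌊ (a + t + c) /2⌋ ≡ suc ⌊ (a + c) /2⌋) ⇔ (a + 2 ≤ a + t × a + t ≤ a + 3)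
    even-case k a+c≡ = begin
      (⌊ (a + t + c) /2⌋ ≡ suc ⌊ (a + c) /2⌋)  ≈⟨ ≡⇔≡ ⌊a+t+c/2⌋≡k+⌊t/2⌋ (cong suc ⌊a+c/2⌋≡k) ⟩
      (k + ⌊ t /2⌋ ≡ suc k)                   ≈⟨ k+m≡1+k⇔m≡1 k _ ⟩
      (⌊ t /2⌋ ≡ 1)                           ≈⟨ ⌊t/2⌋≡1⇔2≤t≤3 t ⟩
      (2 ≤ t × t ≤ 3)                        ≈⟨ m≤n⇔a+m≤a+n a 2 t ×-⇔ m≤n⇔a+m≤a+n a t 3 ⟩
      (a + 2 ≤ a + t × a + t ≤ a + 3)        ∎
      where open Even k a+c≡

-- Distances in the theta graph

module ThetaDistances (a b c : ℕ) (1≤a : 1 ≤ a) (a≤b : a ≤ b) (b≤c : b ≤ c) where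
  open Theta a b c
  open WalkOperations {ThetaV a b c} {ThetaAdj a b c} swap
  open DistanceCharacterisation {ThetaV a b c} {ThetaAdj a b c}

  ℓ : Fin 3 → ℕ
  ℓ = len a b c

  a≤ℓ : ∀ q → a ≤ ℓ q
  a≤ℓ Fin.zero                   = ≤-refl
  a≤ℓ (Fin.suc Fin.zero)          = a≤b
  a≤ℓ (Fin.suc (Fin.suc Fin.zero)) = ≤-trans a≤b b≤c

  ℓ≤c : ∀ q → ℓ q ≤ c
  ℓ≤c Fin.zero                   = ≤-trans a≤b b≤c
  ℓ≤c (Fin.suc Fin.zero)          = b≤c
  ℓ≤c (Fin.suc (Fin.suc Fin.zero)) = ≤-refl

  -- the vertex at distance y from src along path q (tgt once y ≥ ℓ q)
  at : Fin 3 → ℕ → ThetaV a b c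
  at q zero    = src
  at q (suc k) with k <? pred (ℓ q)
  ... | yes k<ℓ = mid q (fromℕ< k<ℓ)
  ... | no  _   = tgt

  pos : ∀ {n} → Fin n → ℕ
  pos j = suc (toℕ j)

  1+pos≤ℓ : ∀ q (j : Fin (pred (ℓ q))) → suc (pos j) ≤ ℓ q
  1+pos≤ℓ q j = helper (ℓ q) (toℕ<n j)
    where
    helper : ∀ n → toℕ j < pred n → suc (pos j) ≤ n
    helper (suc n) j<n = s≤s j<n

  pos≤ℓ : ∀ q (j : Fin (pred (ℓ q))) → pos j ≤ ℓ q
  pos≤ℓ q j = ≤-trans (n≤1+n _) (1+pos≤ℓ q j)

  pos+rest≡ℓ : ∀ q (j : Fin (pred (ℓ q))) → pos j + (ℓ q ∸ pos j) ≡ ℓ q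
  pos+rest≡ℓ q j = m+[n∸m]≡n (pos≤ℓ q j)

  at-pos : ∀ q j → at q (pos j) ≡ mid q j
  at-pos q j with toℕ j <? pred (ℓ q)
  ... | yes j<ℓ = cong (mid q) (fromℕ<-toℕ j j<ℓ)
  ... | no  j≮ℓ = ⊥-elim (j≮ℓ (toℕ<n j))

  at-ℓ : ∀ q → at q (ℓ q) ≡ tgt
  at-ℓ q = end (ℓ q) refl (≤-trans 1≤a (a≤ℓ q))
    where
    end : ∀ n → n ≡ ℓ q → 1 ≤ n → at q n ≡ tgt
    end (suc k) n≡ℓ _ with k <? pred (ℓ q)
    ... | yes k<ℓ = ⊥-elim (n≮n k (subst (k <_) (cong pred (sym n≡ℓ)) k<ℓ))
    ... | no  _   = refl

  at-injective : ∀ q y p (j : Fin (pred (ℓ p))) → at q y ≡ mid p j → q ≡ p × pos j ≡ y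
  at-injective q zero    p j ()
  at-injective q (suc k) p j at≡ with k <? pred (ℓ q)
  at-injective q (suc k) .q .(fromℕ< k<ℓ) refl | yes k<ℓ = refl , cong suc (toℕ-fromℕ< k<ℓ)
  at-injective q (suc k) p  j                ()   | no  _

  adjacent-at : ∀ q y → suc y ≤ ℓ q → ThetaAdj a b c (at q y) (at q (suc y))
  adjacent-at q zero 1≤ℓ with 0 <? pred (ℓ q)
  ... | yes 0<ℓ = inj₁ (first q (fromℕ< 0<ℓ) (toℕ-fromℕ< 0<ℓ))
  ... | no  0≮ℓ = inj₁ (direct q (length-one (ℓ q) 1≤ℓ 0≮ℓ))
    where
    length-one : ∀ n → 1 ≤ n → ¬ 0 < pred n → n ≡ 1
    length-one (suc zero)    _ _   = refl
    length-one (suc (suc n)) _ 0≮n = ⊥-elim (0≮n (s≤s z≤n))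
  adjacent-at q (suc k) 2+k≤ℓ with k <? pred (ℓ q)
  ... | no  k≮ℓ = ⊥-elim (k≮ℓ (<⇒≤pred 2+k≤ℓ))
  ... | yes k<ℓ with suc k <? pred (ℓ q)
  ...   | yes 1+k<ℓ = inj₁ (inner q _ _ (trans (toℕ-fromℕ< 1+k<ℓ) (cong suc (sym (toℕ-fromℕ< k<ℓ)))))
  ...   | no  1+k≮ℓ = inj₁ (last q _ (trans (cong (_+ 2) (toℕ-fromℕ< k<ℓ)) (ends (ℓ q) 2+k≤ℓ 1+k≮ℓ)))
    where
    ends : ∀ n → suc (suc k) ≤ n → ¬ suc k < pred n → k + 2 ≡ n
    ends (suc (suc m)) (s≤s (s≤s k≤m)) 1+k≮m =
      trans (+-comm k 2) (cong (λ t → suc (suc t)) (≤-antisym k≤m (s≤s⁻¹ (≮⇒≥ 1+k≮m))))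

  walkAlong : ∀ q y d → y + d ≤ ℓ q → Walk (at q y) (at q (y + d)) d
  walkAlong q y zero    _ = subst (λ t → Walk (at q y) (at q t) 0) (sym (+-identityʳ y)) here
  walkAlong q y (suc d) y+1+d≤ℓ = step (adjacent-at q y (≤-trans (s≤s (m≤m+n y d)) 1+y+d≤ℓ))
    (subst (λ t → Walk (at q (suc y)) (at q t) d) (sym (+-suc y d)) (walkAlong q (suc y) d 1+y+d≤ℓ))
    where
    1+y+d≤ℓ : suc y + d ≤ ℓ q
    1+y+d≤ℓ = subst (_≤ ℓ q) (+-suc y d) y+1+d≤ℓ

  segment : ∀ q {y y′} → y ≤ y′ → y′ ≤ ℓ q → Walk (at q y) (at q y′) (y′ ∸ y)
  segment q {y} {y′} y≤y′ y′≤ℓ = subst (λ t → Walk (at q y) (at q t) (y′ ∸ y)) (m+[n∸m]≡n y≤y′)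
    (walkAlong q y (y′ ∸ y) (subst (_≤ ℓ q) (sym (m+[n∸m]≡n y≤y′)) y′≤ℓ))

  src⇝tgt : Walk src tgt a
  src⇝tgt = subst (λ v → Walk src v a) (at-ℓ Fin.zero) (segment Fin.zero z≤n ≤-refl)

  src⇝mid : ∀ q j → Walk src (mid q j) (pos j)
  src⇝mid q j = subst (λ v → Walk src v (pos j)) (at-pos q j) (segment q z≤n (pos≤ℓ q j))

  mid⇝tgt : ∀ q j → Walk (mid q j) tgt (ℓ q ∸ pos j)
  mid⇝tgt q j = subst₂ (λ u v → Walk u v (ℓ q ∸ pos j)) (at-pos q j) (at-ℓ q)
    (segment q (pos≤ℓ q j) ≤-refl)

  mid⇝mid : ∀ p (i j : Fin (pred (ℓ p))) → Walk (mid p i) (mid p j) ∣ pos i - pos j ∣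
  mid⇝mid p i j with ≤-total (pos i) (pos j)
  ... | inj₁ i≤j = cast (sym (m≤n⇒∣m-n∣≡n∸m i≤j))
          (subst₂ (λ u v → Walk u v _) (at-pos p i) (at-pos p j) (segment p i≤j (pos≤ℓ p j)))
  ... | inj₂ j≤i = cast (trans (sym (m≤n⇒∣m-n∣≡n∸m j≤i)) (∣-∣-comm (pos j) (pos i)))
          (reverse (subst₂ (λ u v → Walk u v _) (at-pos p j) (at-pos p i) (segment p j≤i (pos≤ℓ p i))))

  -- Distances from src, from tgt and (out of mid p i) through src or tgt.
  dsrc dtgt : ThetaV a b c → ℕ
  dsrc src       = 0
  dsrc tgt       = a
  dsrc (mid q j) = pos j ⊓ (a + (ℓ q ∸ pos j))
  dtgt src       = a
  dtgt tgt       = 0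
  dtgt (mid q j) = (ℓ q ∸ pos j) ⊓ (a + pos j)

  viaEnds : ∀ p → Fin (pred (ℓ p)) → ThetaV a b c → ℕ
  viaEnds p i w = (pos i + dsrc w) ⊓ ((ℓ p ∸ pos i) + dtgt w)

  dmid : ∀ p → Fin (pred (ℓ p)) → ThetaV a b c → ℕ
  dmid p i src       = viaEnds p i src
  dmid p i tgt       = viaEnds p i tgt
  dmid p i (mid q j) with p Fin.≟ q
  ... | yes _ = viaEnds p i (mid q j) ⊓ ∣ pos i - pos j ∣
  ... | no  _ = viaEnds p i (mid q j)

  δ : ThetaV a b c → ThetaV a b c → ℕ
  δ src       = dsrc
  δ tgt       = dtgt
  δ (mid p i) = dmid p i

  rest≡1 : ∀ q (j : Fin (pred (ℓ q))) → toℕ j + 2 ≡ ℓ q → ℓ q ∸ pos j ≡ 1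
  rest≡1 q j j+2≡ℓ = trans (cong (_∸ pos j) (trans (sym j+2≡ℓ) (+-comm (toℕ j) 2))) (m+n∸n≡m 1 (pos j))

  1+pos≡ℓ : ∀ q (j : Fin (pred (ℓ q))) → toℕ j + 2 ≡ ℓ q → suc (pos j) ≡ ℓ q
  1+pos≡ℓ q j j+2≡ℓ = trans (+-comm 2 (toℕ j)) j+2≡ℓ

  dsrc-withinOne : ∀ {w w′} → ThetaEdge a b c w w′ → WithinOne (dsrc w) (dsrc w′)
  dsrc-withinOne (direct q ℓ≡1)   = z≤n , subst (a ≤_) ℓ≡1 (a≤ℓ q)
  dsrc-withinOne (first q j j≡0)  rewrite j≡0 = z≤n , m⊓n≤m 1 _
  dsrc-withinOne (inner q j k k≡) rewrite k≡ =
    withinOne-⊓ (withinOne-suc (pos j)) (withinOne-+ a (withinOne-∸ (ℓ q) (pos j)))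
  dsrc-withinOne (last q j j+2≡ℓ) rewrite rest≡1 q j j+2≡ℓ =
      ≤-trans (m⊓n≤n (pos j) (a + 1)) (≤-reflexive (+-comm a 1))
    , ≤1+⊓ (≤-trans (a≤ℓ q) (≤-reflexive (sym (1+pos≡ℓ q j j+2≡ℓ)))) (m≤n⇒m≤1+n (m≤m+n a 1))

  dtgt-withinOne : ∀ {w w′} → ThetaEdge a b c w w′ → WithinOne (dtgt w) (dtgt w′)
  dtgt-withinOne (direct q ℓ≡1)   = subst (a ≤_) ℓ≡1 (a≤ℓ q) , z≤n
  dtgt-withinOne (first q j j≡0)  rewrite j≡0 =
      ≤1+⊓ (≤-trans (a≤ℓ q) (m≤n+m∸n (ℓ q) 1)) (m≤n⇒m≤1+n (m≤m+n a 1))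
    , ≤-trans (m⊓n≤n _ (a + 1)) (≤-reflexive (+-comm a 1))
  dtgt-withinOne (inner q j k k≡) rewrite k≡ =
    withinOne-⊓ (withinOne-∸ (ℓ q) (pos j)) (withinOne-+ a (withinOne-suc (pos j)))
  dtgt-withinOne (last q j j+2≡ℓ) rewrite rest≡1 q j j+2≡ℓ = m⊓n≤m 1 _ , z≤n

  viaEnds-withinOne : ∀ p i {w w′} → ThetaEdge a b c w w′ → WithinOne (viaEnds p i w) (viaEnds p i w′)
  viaEnds-withinOne p i e =
    withinOne-⊓ (withinOne-+ (pos i) (dsrc-withinOne e)) (withinOne-+ (ℓ p ∸ pos i) (dtgt-withinOne e))

  dmid-withinOne : ∀ p i {w w′} → ThetaEdge a b c w w′ → WithinOne (dmid p i w) (dmid p i w′)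
  dmid-withinOne p i e@(direct q _) = viaEnds-withinOne p i e
  dmid-withinOne p i e@(first q j j≡0) with p Fin.≟ q
  ... | no  _    = viaEnds-withinOne p i e
  ... | yes refl = withinOne-⊓-extend
    (withinOne-+ (pos i) (dsrc-withinOne e)) (withinOne-+ (ℓ p ∸ pos i) (dtgt-withinOne e))
    (≤-trans (m⊓n≤m _ _) (begin
      pos i + 0                  ≡⟨ +-identityʳ (pos i) ⟩
      pos i                      ≤⟨ m≤n+∣m-n∣ (pos i) 1 ⟩
      suc ∣ pos i - 1 ∣          ≡⟨ cong (λ t → suc ∣ pos i - suc t ∣) j≡0 ⟨
      suc ∣ pos i - pos j ∣      ∎))
    where open ≤-Reasoning
  dmid-withinOne p i e@(inner q j k k≡) with p Fin.≟ q
  ... | no  _    = viaEnds-withinOne p i e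
  ... | yes refl = withinOne-⊓ (viaEnds-withinOne p i e)
    (subst (λ t → WithinOne ∣ pos i - pos j ∣ ∣ pos i - t ∣) (cong suc (sym k≡))
      (withinOne-∣-∣ (pos i) (pos j)))
  dmid-withinOne p i e@(last q j j+2≡ℓ) with p Fin.≟ q
  ... | no  _    = viaEnds-withinOne p i e
  ... | yes refl = withinOne-sym (withinOne-⊓-extend
    (withinOne-sym (withinOne-+ (pos i) (dsrc-withinOne e)))
    (withinOne-sym (withinOne-+ (ℓ p ∸ pos i) (dtgt-withinOne e)))
    (≤-trans (m⊓n≤n _ _) (begin
      ℓ p ∸ pos i + 0            ≡⟨ +-identityʳ (ℓ p ∸ pos i) ⟩
      ℓ p ∸ pos i                ≡⟨ cong (_∸ pos i) (1+pos≡ℓ p j j+2≡ℓ) ⟨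
      suc (pos j) ∸ pos i        ≤⟨ 1+n∸m≤1+∣m-n∣ (pos i) (pos j) ⟩
      suc ∣ pos i - pos j ∣      ∎)))
    where
    open ≤-Reasoning
    1+n∸m≤1+∣m-n∣ : ∀ m n → suc n ∸ m ≤ suc ∣ m - n ∣
    1+n∸m≤1+∣m-n∣ zero    n       = ≤-refl
    1+n∸m≤1+∣m-n∣ (suc m) zero    = ≤-trans (≤-reflexive (0∸n≡0 m)) z≤n
    1+n∸m≤1+∣m-n∣ (suc m) (suc n) = 1+n∸m≤1+∣m-n∣ m n

  δ-withinOne : ∀ u {w w′} → ThetaEdge a b c w w′ → WithinOne (δ u w) (δ u w′)
  δ-withinOne src       = dsrc-withinOne
  δ-withinOne tgt       = dtgt-withinOne
  δ-withinOne (mid p i) = dmid-withinOne p i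

  δ-lipschitz : ∀ u {w w′} → ThetaAdj a b c w w′ → δ u w′ ≤ suc (δ u w)
  δ-lipschitz u (inj₁ e) = proj₂ (δ-withinOne u e)
  δ-lipschitz u (inj₂ e) = proj₁ (δ-withinOne u e)

  δ-self : ∀ u → δ u u ≡ 0
  δ-self src       = refl
  δ-self tgt       = refl
  δ-self (mid p i) with p Fin.≟ p
  ... | yes _  = trans (cong (viaEnds p i (mid p i) ⊓_) (∣n-n∣≡0 (pos i))) (⊓-zeroʳ _)
  ... | no p≢p = ⊥-elim (p≢p refl)

  walk-dsrc : ∀ w → Walk src w (dsrc w)
  walk-dsrc src       = here
  walk-dsrc tgt       = src⇝tgt
  walk-dsrc (mid q j) = shorter (src⇝mid q j) (src⇝tgt ++ reverse (mid⇝tgt q j))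

  walk-dtgt : ∀ w → Walk tgt w (dtgt w)
  walk-dtgt src       = reverse src⇝tgt
  walk-dtgt tgt       = here
  walk-dtgt (mid q j) = shorter (reverse (mid⇝tgt q j)) (reverse src⇝tgt ++ src⇝mid q j)

  walk-viaEnds : ∀ p i w → Walk (mid p i) w (viaEnds p i w)
  walk-viaEnds p i w = shorter (reverse (src⇝mid p i) ++ walk-dsrc w) (mid⇝tgt p i ++ walk-dtgt w)

  walk-δ : ∀ u v → Walk u v (δ u v)
  walk-δ src       v         = walk-dsrc v
  walk-δ tgt       v         = walk-dtgt v
  walk-δ (mid p i) src       = walk-viaEnds p i src
  walk-δ (mid p i) tgt       = walk-viaEnds p i tgt
  walk-δ (mid p i) (mid q j) with p Fin.≟ q
  ... | yes refl = shorter (walk-viaEnds p i (mid p j)) (mid⇝mid p i j)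
  ... | no  _    = walk-viaEnds p i (mid q j)

  open ByDistanceFunction δ δ-self δ-lipschitz walk-δ

  beyond-end : ∀ q k z → suc k + z ≡ ℓ q → ¬ k < pred (ℓ q) → z ≡ 0
  beyond-end q k zero    _     _   = refl
  beyond-end q k (suc z) y+z≡ℓ k≮ℓ =
    ⊥-elim (k≮ℓ (subst (λ n → k < pred n) y+z≡ℓ (m<m+n k (s≤s z≤n))))

  dsrc-at : ∀ q y z → y + z ≡ ℓ q → dsrc (at q y) ≡ y ⊓ (a + z)
  dsrc-at q zero    z _ = refl
  dsrc-at q (suc k) z y+z≡ℓ with k <? pred (ℓ q)
  ... | yes k<ℓ rewrite toℕ-fromℕ< k<ℓ = cong (λ t → suc k ⊓ (a + t)) (y+z≡n⇒n∸y≡z y+z≡ℓ)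
  ... | no  k≮ℓ with beyond-end q k z y+z≡ℓ k≮ℓ
  ...   | refl = sym (trans (m≥n⇒m⊓n≡n a+0≤1+k) (+-identityʳ a))
    where
    a+0≤1+k : a + 0 ≤ suc k
    a+0≤1+k = subst₂ _≤_ (sym (+-identityʳ a)) (trans (sym y+z≡ℓ) (+-identityʳ (suc k))) (a≤ℓ q)

  dtgt-at : ∀ q y z → y + z ≡ ℓ q → dtgt (at q y) ≡ z ⊓ (a + y)
  dtgt-at q zero    z z≡ℓ = sym (trans (m≥n⇒m⊓n≡n a+0≤z) (+-identityʳ a))
    where
    a+0≤z : a + 0 ≤ z
    a+0≤z = subst₂ _≤_ (sym (+-identityʳ a)) (sym z≡ℓ) (a≤ℓ q)
  dtgt-at q (suc k) z y+z≡ℓ with k <? pred (ℓ q)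
  ... | yes k<ℓ rewrite toℕ-fromℕ< k<ℓ = cong (_⊓ (a + suc k)) (y+z≡n⇒n∸y≡z y+z≡ℓ)
  ... | no  k≮ℓ with beyond-end q k z y+z≡ℓ k≮ℓ
  ...   | refl = refl

  ≤dmid : ∀ p i w {m} → m ≤ viaEnds p i w → (∀ j → w ≡ mid p j → m ≤ ∣ pos i - pos j ∣) →
          m ≤ dmid p i w
  ≤dmid p i src       m≤ _ = m≤
  ≤dmid p i tgt       m≤ _ = m≤
  ≤dmid p i (mid q j) m≤ m≤direct with p Fin.≟ q
  ... | yes refl = ⊓-glb m≤ (m≤direct j refl)
  ... | no  _    = m≤

  routes⇒≤δ : ∀ p i q y z → y + z ≡ ℓ q → ∀ {m} → RoutesAtLeast m (pos i) (ℓ p ∸ pos i) y z a →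
              (q ≡ p → m ≤ ∣ pos i - y ∣) → m ≤ δ (mid p i) (at q y)
  routes⇒≤δ p i q y z y+z≡ℓ {m} (mkRoutes m≤₁ m≤₂ m≤₃ m≤₄) m≤direct =
    ≤dmid p i (at q y) m≤viaEnds m≤direct′
    where
    x x′ : ℕ
    x  = pos i
    x′ = ℓ p ∸ pos i
    m≤viaEnds : m ≤ viaEnds p i (at q y)
    m≤viaEnds rewrite dsrc-at q y z y+z≡ℓ | dtgt-at q y z y+z≡ℓ
                    | +-distribˡ-⊓ x y (a + z) | +-distribˡ-⊓ x′ z (a + y) =
      ⊓-glb (⊓-glb m≤₁ m≤₂) (⊓-glb m≤₃ m≤₄)
    m≤direct′ : ∀ j → at q y ≡ mid p j → m ≤ ∣ x - pos j ∣
    m≤direct′ j at≡ with at-injective q y p j at≡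
    ... | refl , refl = m≤direct refl

  -- Upper bounds

  r D : ℕ
  r = ⌊ (a + c) /2⌋
  D = ⌊ (b + c) /2⌋

  a≤c : a ≤ c
  a≤c = ≤-trans a≤b b≤c

  ⌊c+c/2⌋≡c : ⌊ (c + c) /2⌋ ≡ c
  ⌊c+c/2⌋≡c = sym (n≡⌊n+n/2⌋ c)

  r≤c : r ≤ c
  r≤c = ≤-trans (⌊n/2⌋-mono (+-monoˡ-≤ c a≤c)) (≤-reflexive ⌊c+c/2⌋≡c)

  D≤c : D ≤ c
  D≤c = ≤-trans (⌊n/2⌋-mono (+-monoˡ-≤ c b≤c)) (≤-reflexive ⌊c+c/2⌋≡c)

  a≤r : a ≤ r
  a≤r = ≤⌊/2⌋ (+-monoʳ-≤ a a≤c)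

  r≤D : r ≤ D
  r≤D = ⌊n/2⌋-mono (+-monoˡ-≤ c a≤b)

  ⊓≤r : ∀ {m n} → m + n ≤ a + c → m ⊓ n ≤ r
  ⊓≤r {m} {n} m+n≤ = ≤-trans (m⊓n≤⌊m+n/2⌋ m n) (⌊n/2⌋-mono m+n≤)

  ⊓≤D : ∀ {m n} → m + n ≤ b + c → m ⊓ n ≤ D
  ⊓≤D {m} {n} m+n≤ = ≤-trans (m⊓n≤⌊m+n/2⌋ m n) (⌊n/2⌋-mono m+n≤)

  a+ℓ≤a+c : ∀ q → a + ℓ q ≤ a + c
  a+ℓ≤a+c q = +-monoʳ-≤ a (ℓ≤c q)

  a+ℓ≤b+c : ∀ q → a + ℓ q ≤ b + c
  a+ℓ≤b+c q = +-mono-≤ a≤b (ℓ≤c q)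

  ℓ+ℓ≤b+c : ∀ p q → ¬ p ≡ q → ℓ p + ℓ q ≤ b + c
  ℓ+ℓ≤b+c Fin.zero                      Fin.zero                      p≢q = ⊥-elim (p≢q refl)
  ℓ+ℓ≤b+c Fin.zero                      (Fin.suc Fin.zero)            _   =
    ≤-trans (+-monoˡ-≤ b a≤c) (≤-reflexive (+-comm c b))
  ℓ+ℓ≤b+c Fin.zero                      (Fin.suc (Fin.suc Fin.zero))  _   = +-monoˡ-≤ c a≤b
  ℓ+ℓ≤b+c (Fin.suc Fin.zero)            Fin.zero                      _   = +-monoʳ-≤ b a≤c
  ℓ+ℓ≤b+c (Fin.suc Fin.zero)            (Fin.suc Fin.zero)            p≢q = ⊥-elim (p≢q refl)
  ℓ+ℓ≤b+c (Fin.suc Fin.zero)            (Fin.suc (Fin.suc Fin.zero))  _   = ≤-refl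
  ℓ+ℓ≤b+c (Fin.suc (Fin.suc Fin.zero))  Fin.zero                      _   =
    ≤-trans (+-monoʳ-≤ c a≤b) (≤-reflexive (+-comm c b))
  ℓ+ℓ≤b+c (Fin.suc (Fin.suc Fin.zero))  (Fin.suc Fin.zero)            _   = ≤-reflexive (+-comm c b)
  ℓ+ℓ≤b+c (Fin.suc (Fin.suc Fin.zero))  (Fin.suc (Fin.suc Fin.zero))  p≢q = ⊥-elim (p≢q refl)

  dsrc≤r : ∀ w → dsrc w ≤ r
  dsrc≤r src       = z≤n
  dsrc≤r tgt       = a≤r
  dsrc≤r (mid q j) = ⊓≤r (begin
    pos j + (a + (ℓ q ∸ pos j))  ≡⟨ x∙yz≈y∙xz (pos j) a (ℓ q ∸ pos j) ⟩
    a + (pos j + (ℓ q ∸ pos j))  ≡⟨ cong (a +_) (pos+rest≡ℓ q j) ⟩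
    a + ℓ q                      ≤⟨ a+ℓ≤a+c q ⟩
    a + c                        ∎)
    where open ≤-Reasoning

  dtgt≤r : ∀ w → dtgt w ≤ r
  dtgt≤r src       = a≤r
  dtgt≤r tgt       = z≤n
  dtgt≤r (mid q j) = ⊓≤r (begin
    (ℓ q ∸ pos j) + (a + pos j)  ≡⟨ x∙yz≈y∙xz (ℓ q ∸ pos j) a (pos j) ⟩
    a + ((ℓ q ∸ pos j) + pos j)  ≡⟨ cong (a +_) (m∸n+n≡m (pos≤ℓ q j)) ⟩
    a + ℓ q                      ≤⟨ a+ℓ≤a+c q ⟩
    a + c                        ∎)
    where open ≤-Reasoning

  viaEnds≤D : ∀ p i w {s t} → dsrc w ≤ s → dtgt w ≤ t → ℓ p + (s + t) ≤ b + c → viaEnds p i w ≤ D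
  viaEnds≤D p i w {s} {t} dsrc≤s dtgt≤t sum≤ =
    ≤-trans (⊓-mono-≤ (+-monoʳ-≤ (pos i) dsrc≤s) (+-monoʳ-≤ (ℓ p ∸ pos i) dtgt≤t)) (⊓≤D (begin
      (pos i + s) + ((ℓ p ∸ pos i) + t)  ≡⟨ interchange (pos i) s (ℓ p ∸ pos i) t ⟩
      (pos i + (ℓ p ∸ pos i)) + (s + t)  ≡⟨ cong (_+ (s + t)) (pos+rest≡ℓ p i) ⟩
      ℓ p + (s + t)                      ≤⟨ sum≤ ⟩
      b + c                              ∎))
    where open ≤-Reasoning

  dmid≤D : ∀ p i w → dmid p i w ≤ D
  dmid≤D p i src = viaEnds≤D p i src ≤-refl ≤-refl
    (≤-trans (≤-reflexive (+-comm (ℓ p) a)) (a+ℓ≤b+c p))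
  dmid≤D p i tgt = viaEnds≤D p i tgt ≤-refl ≤-refl
    (≤-trans (≤-reflexive (trans (cong (ℓ p +_) (+-identityʳ a)) (+-comm (ℓ p) a))) (a+ℓ≤b+c p))
  dmid≤D p i (mid q j) with p Fin.≟ q
  ... | no p≢q = viaEnds≤D p i (mid q j) (m⊓n≤m _ _) (m⊓n≤m _ _)
    (≤-trans (≤-reflexive (cong (ℓ p +_) (pos+rest≡ℓ q j))) (ℓ+ℓ≤b+c p q p≢q))
  ... | yes refl with ≤-total (pos i) (pos j)
  ...   | inj₁ i≤j = ≤-trans
    (⊓-mono-≤ (≤-trans (m⊓n≤m _ _) (+-monoʳ-≤ (pos i) (m⊓n≤n _ _))) (≤-reflexive (m≤n⇒∣m-n∣≡n∸m i≤j)))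
    (⊓≤D (≤-trans (≤-reflexive (x+[d+[n∸y]]+[y∸x]≡d+n a i≤j (pos≤ℓ p j))) (a+ℓ≤b+c p)))
  ...   | inj₂ j≤i = ≤-trans
    (⊓-mono-≤ (≤-trans (m⊓n≤n _ _) (+-monoʳ-≤ (ℓ p ∸ pos i) (m⊓n≤n _ _)))
              (≤-reflexive (trans (∣-∣-comm (pos i) (pos j)) (m≤n⇒∣m-n∣≡n∸m j≤i))))
    (⊓≤D (≤-trans (≤-reflexive ([n∸x]+[d+y]+[x∸y]≡d+n a j≤i (pos≤ℓ p i))) (a+ℓ≤b+c p)))

  δ≤D : ∀ u v → δ u v ≤ D
  δ≤D src       v = ≤-trans (dsrc≤r v) r≤D
  δ≤D tgt       v = ≤-trans (dtgt≤r v) r≤D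
  δ≤D (mid p i) v = dmid≤D p i v

  -- Lower bounds

  pathC : Fin 3
  pathC = Fin.suc (Fin.suc Fin.zero)

  2r≤a+c : r + r ≤ a + c
  2r≤a+c = ⌊n/2⌋+⌊n/2⌋≤n (a + c)

  2r≤a+[y+z] : ∀ y z → y + z ≡ c → r + r ≤ a + (y + z)
  2r≤a+[y+z] y z y+z≡c = subst (λ t → r + r ≤ a + t) (sym y+z≡c) 2r≤a+c

  r≤y+z : ∀ y z → y + z ≡ c → r ≤ y + z
  r≤y+z y z y+z≡c = subst (r ≤_) (sym y+z≡c) r≤c

  r≤a+[c∸r] : r ≤ a + (c ∸ r)
  r≤a+[c∸r] = ≤-by-balance (2r≤a+[y+z] r (c ∸ r) (m+[n∸m]≡n r≤c)) (shuffle r a (c ∸ r))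
    where
    shuffle : ∀ r a w → r + (a + (r + w)) ≡ (a + w) + (r + r)
    shuffle = solve-∀

  dsrc-antipode : dsrc (at pathC r) ≡ r
  dsrc-antipode = trans (dsrc-at pathC r (c ∸ r) (m+[n∸m]≡n r≤c)) (m≤n⇒m⊓n≡m r≤a+[c∸r])

  dtgt-antipode : r ≤ dtgt (at pathC (c ∸ r))
  dtgt-antipode = subst (r ≤_) (sym (dtgt-at pathC (c ∸ r) r (m∸n+n≡m r≤c))) (⊓-glb ≤-refl r≤a+[c∸r])

  antipode-across : ∀ x x′ → a ≤ x + x′ → ∃₂ λ y z → y + z ≡ c × RoutesAtLeast r x x′ y z a
  antipode-across x x′ a≤x+x′ with x ≤? x′ + a
  ... | yes x≤x′+a = y , z , y+z≡c ,
    routesAtLeast-across x x′ a r y z a≤x+x′ (2r≤a+[y+z] y z y+z≡c) (r≤y+z y z y+z≡c) x≤x′+a refl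
    where
    y z : ℕ
    y = r ∸ x
    z = c ∸ y
    y+z≡c : y + z ≡ c
    y+z≡c = m+[n∸m]≡n (≤-trans (m∸n≤m r x) r≤c)
  ... | no  x≰x′+a = y , z , m∸n+n≡m z≤c ,
    routesAtLeast-flip (routesAtLeast-across x′ x a r z y
      (≤-trans a≤x+x′ (≤-reflexive (+-comm x x′))) (2r≤a+[y+z] z y z+y≡c) (r≤y+z z y z+y≡c) x′≤x+a refl)
    where
    y z : ℕ
    z = r ∸ x′
    y = c ∸ z
    z≤c : z ≤ c
    z≤c = ≤-trans (m∸n≤m r x′) r≤c
    z+y≡c : z + y ≡ c
    z+y≡c = m+[n∸m]≡n z≤c
    x′≤x+a : x′ ≤ x + a
    x′≤x+a = ≤-trans (≤-trans (m≤m+n x′ a) (<⇒≤ (≰⇒> x≰x′+a))) (m≤m+n x a)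

  far-off-c : ∀ p i → ¬ pathC ≡ p → ∃ λ v → r ≤ δ (mid p i) v
  far-off-c p i c≢p with antipode-across (pos i) (ℓ p ∸ pos i) (subst (a ≤_) (sym (pos+rest≡ℓ p i)) (a≤ℓ p))
  ... | y , z , y+z≡c , routes =
    at pathC y , routes⇒≤δ p i pathC y z y+z≡c routes (λ c≡p → ⊥-elim (c≢p c≡p))

  -- the antipode is r further along P_c, else r back along P_c, else on P_a
  far-on-c : ∀ i → ∃ λ v → r ≤ δ (mid pathC i) v
  far-on-c i with pos i + r ≤? c
  ... | yes x+r≤c = at pathC (x + r) , routes⇒≤δ pathC i pathC (x + r) z y+z≡c
    (subst (λ x′ → RoutesAtLeast r x x′ (x + r) z a) (sym x′≡r+z)
      (routesAtLeast-ahead x r a z (2r≤a+[y+z] (x + r) z y+z≡c)))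
    (λ _ → ≤-reflexive (sym (∣m-m+n∣≡n x r)))
    where
    x z : ℕ
    x = pos i
    z = c ∸ (x + r)
    y+z≡c : x + r + z ≡ c
    y+z≡c = m+[n∸m]≡n x+r≤c
    x′≡r+z : c ∸ x ≡ r + z
    x′≡r+z = +-cancelˡ-≡ x (c ∸ x) (r + z)
      (trans (pos+rest≡ℓ pathC i) (trans (sym y+z≡c) (+-assoc x r z)))
  ... | no x+r≰c with r ≤? pos i
  ...   | yes r≤x = at pathC y , routes⇒≤δ pathC i pathC y (x′ + r) (trans (+-comm y (x′ + r)) z+y≡c)
    (subst (λ x → RoutesAtLeast r x x′ y (x′ + r) a) r+y≡x
      (routesAtLeast-flip (routesAtLeast-ahead x′ r a y (2r≤a+[y+z] (x′ + r) y z+y≡c))))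
    (λ _ → ≤-reflexive (sym ∣x-y∣≡r))
    where
    x x′ y : ℕ
    x  = pos i
    x′ = c ∸ x
    y  = x ∸ r
    r+y≡x : r + y ≡ x
    r+y≡x = m+[n∸m]≡n r≤x
    z+y≡c : x′ + r + y ≡ c
    z+y≡c = trans (+-assoc x′ r y)
      (trans (cong (x′ +_) r+y≡x) (trans (+-comm x′ x) (pos+rest≡ℓ pathC i)))
    ∣x-y∣≡r : ∣ x - y ∣ ≡ r
    ∣x-y∣≡r = trans (cong (λ t → ∣ t - y ∣) (sym (trans (+-comm y r) r+y≡x)))
      (trans (∣-∣-comm (y + r) y) (∣m-m+n∣≡n y r))
  ...   | no r≰x = at Fin.zero y , routes⇒≤δ pathC i Fin.zero y z y+z≡a
    (subst₂ (λ s t → RoutesAtLeast s x x′ y z t) x′+z≡r y+z≡a (routesAtLeast-onDetour x x′ y z 2r≤))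
    (λ ())
    where
    x x′ z y : ℕ
    x  = pos i
    x′ = c ∸ x
    z  = (x + r) ∸ c
    y  = a ∸ z
    x′+z≡r : x′ + z ≡ r
    x′+z≡r = +-cancelˡ-≡ x (x′ + z) r (trans (sym (+-assoc x x′ z))
      (trans (cong (_+ z) (pos+rest≡ℓ pathC i)) (m+[n∸m]≡n (<⇒≤ (≰⇒> x+r≰c)))))
    z≤a : z ≤ a
    z≤a = m≤n+o⇒m∸n≤o (x + r) c
      (≤-trans (+-monoˡ-≤ r (<⇒≤ (≰⇒> r≰x))) (≤-trans 2r≤a+c (≤-reflexive (+-comm a c))))
    y+z≡a : y + z ≡ a
    y+z≡a = m∸n+n≡m z≤a
    2r≤ : (x′ + z) + (x′ + z) ≤ (y + z) + (x + x′)
    2r≤ = subst₂ (λ s t → s + s ≤ t + (x + x′)) (sym x′+z≡r) (sym y+z≡a)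
      (subst (λ t → r + r ≤ a + t) (sym (pos+rest≡ℓ pathC i)) 2r≤a+c)

  far : ∀ u → ∃ λ v → r ≤ δ u v
  far src                                = at pathC r , ≤-reflexive (sym dsrc-antipode)
  far tgt                                = at pathC (c ∸ r) , dtgt-antipode
  far (mid Fin.zero i)                   = far-off-c Fin.zero i (λ ())
  far (mid (Fin.suc Fin.zero) i)         = far-off-c (Fin.suc Fin.zero) i (λ ())
  far (mid (Fin.suc (Fin.suc Fin.zero)) i) = far-on-c i

  pathB : Fin 3
  pathB = Fin.suc Fin.zero

  diameter-attained : 2 ≤ b → ∃₂ λ u v → δ u v ≡ D
  diameter-attained 2≤b = mid pathB centre , at pathC y , ≤-antisym (δ≤D (mid pathB centre) (at pathC y))
    (routes⇒≤δ pathB centre pathC y z y+z≡c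
      (subst (λ s → RoutesAtLeast s x x′ y z a) x+y≡D
        (routesAtLeast-midpoint x x′ y z a 1≤a 2x≤x+x′ x+x′≤1+2x 2[x+y]≤[x+x′]+[y+z]))
      (λ ()))
    where
    centre : Fin (pred b)
    centre = fromℕ< (⌊n/2⌋∸1<pred[n] 2≤b)
    x x′ y z : ℕ
    x  = pos centre
    x′ = b ∸ x
    y  = D ∸ x
    z  = c ∸ y
    x≡⌊b/2⌋ : x ≡ ⌊ b /2⌋
    x≡⌊b/2⌋ = trans (cong suc (toℕ-fromℕ< (⌊n/2⌋∸1<pred[n] 2≤b))) (m+[n∸m]≡n (1≤⌊n/2⌋ 2≤b))
    x+x′≡b : x + x′ ≡ b
    x+x′≡b = pos+rest≡ℓ pathB centre
    x+y≡D : x + y ≡ D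
    x+y≡D = m+[n∸m]≡n (subst (_≤ D) (sym x≡⌊b/2⌋) (⌊n/2⌋-mono (m≤m+n b c)))
    y+z≡c : y + z ≡ c
    y+z≡c = m+[n∸m]≡n (≤-trans (m∸n≤m D x) D≤c)
    2x≤x+x′ : x + x ≤ x + x′
    2x≤x+x′ = subst₂ (λ s t → s + s ≤ t) (sym x≡⌊b/2⌋) (sym x+x′≡b) (⌊n/2⌋+⌊n/2⌋≤n b)
    x+x′≤1+2x : x + x′ ≤ suc (x + x)
    x+x′≤1+2x = subst₂ (λ s t → s ≤ suc (t + t)) (sym x+x′≡b) (sym x≡⌊b/2⌋) (n≤1+⌊n/2⌋+⌊n/2⌋ b)
    2[x+y]≤[x+x′]+[y+z] : (x + y) + (x + y) ≤ (x + x′) + (y + z)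
    2[x+y]≤[x+x′]+[y+z] = subst₂ (λ s t → s + s ≤ t) (sym x+y≡D) (sym (cong₂ _+_ x+x′≡b y+z≡c))
      (⌊n/2⌋+⌊n/2⌋≤n (b + c))

  radius : IsRad r
  radius = isRad {src} dsrc≤r (at pathC r , dsrc-antipode) far

  diameter : 2 ≤ b → IsDiam D
  diameter 2≤b = isDiam δ≤D (diameter-attained 2≤b)

lemma3 : (a b c : ℕ) → 1 ≤ a → a ≤ b → b ≤ c → 2 ≤ b →
    Theta.IsRad a b c ⌊ (a + c) /2⌋
    × Theta.IsDiam a b c ⌊ (b + c) /2⌋
    × (Theta.SelfCentered a b c ⇔
        ((¬ (2 ∣ (a + c)) × b ≡ a) ⊎ (2 ∣ (a + c) × b ≤ a + 1)))
    × (Theta.DiamIsRadPlusOne a b c ⇔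
        ((¬ (2 ∣ (a + c)) × a + 1 ≤ b × b ≤ a + 2)
          ⊎ (2 ∣ (a + c) × a + 2 ≤ b × b ≤ a + 3)))
lemma3 a b c 1≤a a≤b b≤c 2≤b with m≤n⇒∃[o]m+o≡n a≤b
... | t , refl =
    radius
  , diameter 2≤b
  , ⇔.trans (selfCentered⇔ radius (diameter 2≤b)) sameHalf⇔
  , ⇔.trans (diamIsRadPlusOne⇔ radius (diameter 2≤b)) nextHalf⇔
  where
  open ThetaDistances a (a + t) c 1≤a a≤b b≤c
  open HalfComparison a t c
  open DistanceCharacterisation
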